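{- For a reduced closure system $\langle S,\phi\rangle$, the $D$-basis is contained in the dependence relation basis: $\Sigma_D\subseteq\Sigma_\delta$.
   Context: A closure system is a pair $\langle S,\phi\rangle$ with $S$ a finite nonempty set and $\phi$ a closure operator on $2^S$; it is reduced if $\phi(\{i\})=\phi(\{j\})$ implies $i=j$. Write $\phi(y)$ for $\phi(\{y\})$. Implications are pairs $X\rightarrow y$ ($X\subseteq S$, $y\in S$). For $X,Y\subseteq S$, $X\ll Y$ means every $x\in X$ lies in $\phi(y)$ for some $y\in Y$. $X$ is a cover of $x$ ($x\triangleleft X$) if $x\in\phi(X)\setminus\bigcup_{x'\in X}\phi(x')$; a cover $Y$ of $x$ is minimal if for every cover $Z$ of $x$, $Z\ll Y$ implies $Y\subseteq Z$. The $D$-basis is $\Sigma_D=\{y\rightarrow x: y\in S,\ x\in\phi(y)\setminus\{y\}\}\cup\{X\rightarrow x: X\text{ a minimal cover of }x\}$ (implications with singleton premise $\{y\}$ are written $y\rightarrow x$). The dependence relation basis is $\Sigma_\delta=\{X\rightarrow y: y\in\phi(X)\setminus X \text{ and } y\notin\phi(Z)\text{ for all } Z\subsetneq X\}$.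
   Formalization: The reduced closure system ⟨S,φ⟩ is also assumed to satisfy φ(∅) = ∅, so φ fixes the empty set. The statement above fails without it. -}

module Defs where

open import Data.Nat using (ℕ)
open import Data.Fin using (Fin)
open import Data.Fin.Subset using (Subset; _∈_; _∉_; _⊆_; _⊂_; ⁅_⁆)
open import Data.Product using (Σ; ∃; _×_; _,_)
open import Data.Sum using (_⊎_)
open import Relation.Binary.PropositionalEquality using (_≡_; _≢_)

record ClosureSystem (n : ℕ) : Set where
  field
    φ          : Subset n → Subset n
    extensive  : ∀ X → X ⊆ φ X
    monotone   : ∀ {X Y} → X ⊆ Y → φ X ⊆ φ Y
    idempotent : ∀ X → φ (φ X) ≡ φ X

module _ {n : ℕ} (C : ClosureSystem n) where
  open ClosureSystem C

  Reduced : Set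
  Reduced = ∀ i j → φ ⁅ i ⁆ ≡ φ ⁅ j ⁆ → i ≡ j

  _≪_ : Subset n → Subset n → Set
  X ≪ Y = ∀ x → x ∈ X → ∃ λ y → y ∈ Y × x ∈ φ ⁅ y ⁆

  Cover : Fin n → Subset n → Set
  Cover x X = x ∈ φ X × (∀ x′ → x′ ∈ X → x ∉ φ ⁅ x′ ⁆)

  MinimalCover : Fin n → Subset n → Set
  MinimalCover x Y = Cover x Y × (∀ Z → Cover x Z → Z ≪ Y → Y ⊆ Z)

  Implication : Set
  Implication = Subset n × Fin n

  InΣD : Implication → Set
  InΣD (X , x) =
    (∃ λ y → X ≡ ⁅ y ⁆ × x ∈ φ ⁅ y ⁆ × x ≢ y)
    ⊎ MinimalCover x X

  InΣδ : Implication → Set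
  InΣδ (X , y) = y ∈ φ X × y ∉ X × (∀ Z → Z ⊂ X → y ∉ φ Z)

-- A singleton premise y → x is dependence-minimal because the only proper
-- subset of {y} is ∅, whose closure is ∅.  A minimal cover X of x is
-- dependence-minimal because any Z ⊂ X with x ∈ φ Z is again a cover of x
-- with Z ≪ X, so minimality forces X ⊆ Z, contradicting properness.
module Submission where

open import Defs
open import Data.Nat using (ℕ; suc)
open import Data.Fin using (Fin)
open import Data.Fin.Subset using (Subset; ⊥; _∈_; _∉_; _⊆_; _⊂_; ⁅_⁆)
open import Data.Fin.Subset.Properties using (x∈⁅x⁆; x∈⁅y⁆⇒x≡y; x≢y⇒x∉⁅y⁆; ∉⊥)
open import Data.Product using (_,_; proj₁)
open import Data.Sum using (inj₁; inj₂)
open import Relation.Nullary using (contradiction)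
open import Relation.Binary.PropositionalEquality using (_≡_; _≢_; refl; sym; trans; subst)

⊂⁅y⁆⇒⊆⊥ : ∀ {n} {Z : Subset n} {y : Fin n} → Z ⊂ ⁅ y ⁆ → Z ⊆ ⊥
⊂⁅y⁆⇒⊆⊥ {Z = Z} {y} (Z⊆y , w , w∈y , w∉Z) z∈Z = contradiction (subst (_∈ Z) z≡w z∈Z) w∉Z
  where
  z≡w : _ ≡ w
  z≡w = trans (x∈⁅y⁆⇒x≡y y (Z⊆y z∈Z)) (sym (x∈⁅y⁆⇒x≡y y w∈y))

module _ {n : ℕ} (C : ClosureSystem n) where
  open ClosureSystem C

  ⊆⇒≪ : ∀ {Z Y} → Z ⊆ Y → _≪_ C Z Y
  ⊆⇒≪ Z⊆Y z z∈Z = z , Z⊆Y z∈Z , extensive ⁅ z ⁆ (x∈⁅x⁆ z)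

  cover-∉ : ∀ {x X} → Cover C x X → x ∉ X
  cover-∉ (_ , x∉φ) x∈X = x∉φ _ x∈X (extensive ⁅ _ ⁆ (x∈⁅x⁆ _))

  cover-⊆ : ∀ {x X Z} → Cover C x X → Z ⊆ X → x ∈ φ Z → Cover C x Z
  cover-⊆ (_ , x∉φ) Z⊆X x∈φZ = x∈φZ , λ z z∈Z → x∉φ z (Z⊆X z∈Z)

  minimalCover⇒InΣδ : ∀ {x X} → MinimalCover C x X → InΣδ C (X , x)
  minimalCover⇒InΣδ (cover , minimal) =
    proj₁ cover , cover-∉ cover ,
    λ { Z (Z⊆X , w , w∈X , w∉Z) x∈φZ →
          w∉Z (minimal Z (cover-⊆ cover Z⊆X x∈φZ) (⊆⇒≪ Z⊆X) w∈X) }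

  singleton⇒InΣδ : φ ⊥ ≡ ⊥ → ∀ {x y} → x ∈ φ ⁅ y ⁆ → x ≢ y → InΣδ C (⁅ y ⁆ , x)
  singleton⇒InΣδ φ⊥≡⊥ x∈φy x≢y =
    x∈φy , x≢y⇒x∉⁅y⁆ x≢y ,
    λ Z Z⊂y x∈φZ → ∉⊥ (subst (_ ∈_) φ⊥≡⊥ (monotone (⊂⁅y⁆⇒⊆⊥ Z⊂y) x∈φZ))

lemma8 : ∀ {m : ℕ} (C : ClosureSystem (suc m)) → Reduced C → ClosureSystem.φ C ⊥ ≡ ⊥ →
           ∀ (I : Implication C) → InΣD C I → InΣδ C I
lemma8 C _ φ⊥≡⊥ (_ , _) (inj₁ (_ , refl , x∈φy , x≢y)) = singleton⇒InΣδ C φ⊥≡⊥ x∈φy x≢y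
lemma8 C _ _    (_ , _) (inj₂ minimalCover)            = minimalCover⇒InΣδ C minimalCover
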